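{- In the type theory described in the context, for any type $X$, any classical predicate $P:X\to\mathsf{Prop}$ and any $x:\mathsf{M}X$, the following hold: $\forall^{\mathsf{M}}x\,P=\big(\forall y:X.\,\mathsf{pic}_X\,x\,y\to P\,y\big)$ and $\exists^{\mathsf{M}}x\,P=\big(\exists y:X.\,\mathsf{pic}_X\,x\,y\wedge P\,y\big)$; moreover for any $y:X$, $(y\in^{\mathsf{M}}x)=\mathsf{pic}_X\,x\,y$.
   Context: Work in an extensional dependent type theory with a universe $\mathsf{Type}$ and a universe $\mathsf{Prop}$ of classical propositions (closed under $\to,\times,\Pi$, with classical $\lor,\exists$; identity types in $\mathsf{Prop}$), assuming excluded middle for $\mathsf{Prop}$, propositional extensionality $(P\leftrightarrow Q)\to P=Q$, and functional extensionality. Nondeterminism: a type former $\mathsf{M}:\mathsf{Type}\to\mathsf{Type}$ with $\mathsf{unit}^{\mathsf{M}}$, $\mathsf{mult}^{\mathsf{M}}$, $\mathsf{lift}^{\mathsf{M}}$ satisfying the monad laws. Let $\mathsf{P}_+X:=\Sigma(S:X\to\mathsf{Prop}).\,\exists x.\,S\,x$ (classical nonempty powerset monad: unit $x\mapsto(\lambda y.\,x=y)$, lift $f$ sends $S$ to $\lambda y.\,\exists z.\,y=f\,z\wedge S\,z$, multiplication by union). Assume a natural transformation $\mathsf{picture}_X:\mathsf{M}X\to\mathsf{P}_+X$, injective, commuting with units and multiplications, with $\mathsf{lift}^{\mathsf{P}_+}\mathsf{picture}_X$ an equivalence; $\mathsf{pic}_X\,x\,y:=\pi_1(\mathsf{picture}_X\,x)\,y$.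 Assume a term of type $\prod_{x:\mathsf{M}X}\mathsf{M}(\Sigma y:X.\,\mathsf{pic}_X\,x\,y)$, and that for subsingleton $X$, $\mathsf{unit}^{\mathsf{M}}_X$ is an equivalence. Definitions: $\wedge^{\mathsf{M}}(z:\mathsf{M}\mathsf{Prop}):=(z=\mathsf{unit}^{\mathsf{M}}\mathsf{True})$, $\vee^{\mathsf{M}}(z):=\neg(z=\mathsf{unit}^{\mathsf{M}}\mathsf{False})$; $\forall^{\mathsf{M}}x\,P:=\wedge^{\mathsf{M}}(\mathsf{lift}^{\mathsf{M}}P\,x)$, $\exists^{\mathsf{M}}x\,P:=\vee^{\mathsf{M}}(\mathsf{lift}^{\mathsf{M}}P\,x)$, and $y\in^{\mathsf{M}}x:=\exists^{\mathsf{M}}x\,(\lambda z.\,y=z)$. -}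

module Defs where

open import Data.Product using (Σ; Σ-syntax; _×_; _,_; proj₁; proj₂)
open import Data.Empty using (⊥)
open import Data.Unit using (⊤)
open import Relation.Binary.PropositionalEquality using (_≡_; refl)
open import Function.Base using (id; _∘_)

_⇔_ : Set → Set → Set
A ⇔ B = (A → B) × (B → A)

-- Agda's own Prop is predicative, while the paper's Prop is an
-- impredicative universe living in Type (so that M Prop makes sense and
-- Prop is closed under Π over arbitrary types).  We therefore take
-- Type := Set and describe Prop abstractly as a type Ω : Set with a
-- decoding ⟦_⟧ into proof-irrelevant types, closed under the connectives.
-- Negative connectives (True, False, →, ×, Π, identity) decode to the
-- corresponding Agda types; the classical ∃ and ∨ are given by
-- introduction rules and eliminators into Prop only (as for Coq's
-- inductive ∃ / ∨ in Prop).

record Logic : Set₁ where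
  infixr 6 _∧_
  infixr 5 _∨_
  infixr 4 _⇒_
  field
    Ω     : Set
    ⟦_⟧   : Ω → Set
    ⟦⟧-prop : (P : Ω) (a b : ⟦ P ⟧) → a ≡ b

    True  : Ω
    True-spec : ⟦ True ⟧ ⇔ ⊤
    False : Ω
    False-spec : ⟦ False ⟧ ⇔ ⊥
    _⇒_   : Ω → Ω → Ω
    ⇒-spec : (P Q : Ω) → ⟦ P ⇒ Q ⟧ ⇔ (⟦ P ⟧ → ⟦ Q ⟧)
    _∧_   : Ω → Ω → Ω
    ∧-spec : (P Q : Ω) → ⟦ P ∧ Q ⟧ ⇔ (⟦ P ⟧ × ⟦ Q ⟧)
    Πₚ    : (A : Set) → (A → Ω) → Ω
    Π-spec : (A : Set) (B : A → Ω) → ⟦ Πₚ A B ⟧ ⇔ ((a : A) → ⟦ B a ⟧)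
    Id    : (A : Set) → A → A → Ω
    Id-spec : (A : Set) (a b : A) → ⟦ Id A a b ⟧ ⇔ (a ≡ b)

    _∨_   : Ω → Ω → Ω
    ∨-inl : (P Q : Ω) → ⟦ P ⟧ → ⟦ P ∨ Q ⟧
    ∨-inr : (P Q : Ω) → ⟦ Q ⟧ → ⟦ P ∨ Q ⟧
    ∨-elim : (P Q R : Ω) → ⟦ P ∨ Q ⟧ → (⟦ P ⟧ → ⟦ R ⟧) → (⟦ Q ⟧ → ⟦ R ⟧) → ⟦ R ⟧

    ∃ₚ    : (A : Set) → (A → Ω) → Ω
    ∃-intro : (A : Set) (B : A → Ω) (a : A) → ⟦ B a ⟧ → ⟦ ∃ₚ A B ⟧
    ∃-elim : (A : Set) (B : A → Ω) (R : Ω) → ⟦ ∃ₚ A B ⟧ → ((a : A) → ⟦ B a ⟧ → ⟦ R ⟧) → ⟦ R ⟧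

    lem     : (P : Ω) → ⟦ P ∨ (P ⇒ False) ⟧
    propext : (P Q : Ω) → (⟦ P ⟧ → ⟦ Q ⟧) → (⟦ Q ⟧ → ⟦ P ⟧) → P ≡ Q

  ¬ₚ : Ω → Ω
  ¬ₚ P = P ⇒ False

FunExt : Set₁
FunExt = {A : Set} {B : A → Set} {f g : (a : A) → B a} → ((a : A) → f a ≡ g a) → f ≡ g

-- Equivalences (bi-invertible maps; in an extensional setting with UIP
-- this is the usual notion).
IsEquiv : {A B : Set} → (A → B) → Set
IsEquiv {A} {B} f = Σ[ g ∈ (B → A) ] (((a : A) → g (f a) ≡ a) × ((b : B) → f (g b) ≡ b))

IsSubsingleton : Set → Set
IsSubsingleton A = (a b : A) → a ≡ b

record Monad : Set₁ where
  field
    M    : Set → Set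
    unit : {X : Set} → X → M X
    mult : {X : Set} → M (M X) → M X
    lift : {X Y : Set} → (X → Y) → M X → M Y
    lift-id   : {X : Set} (x : M X) → lift id x ≡ x
    lift-comp : {X Y Z : Set} (g : Y → Z) (f : X → Y) (x : M X) → lift (g ∘ f) x ≡ lift g (lift f x)
    unit-nat : {X Y : Set} (f : X → Y) (x : X) → lift f (unit x) ≡ unit (f x)
    mult-nat : {X Y : Set} (f : X → Y) (m : M (M X)) → lift f (mult m) ≡ mult (lift (lift f) m)
    mult-unit  : {X : Set} (x : M X) → mult (unit x) ≡ x
    mult-lift-unit : {X : Set} (x : M X) → mult (lift unit x) ≡ x
    mult-assoc : {X : Set} (m : M (M (M X))) → mult (mult m) ≡ mult (lift mult m)

module Powerset (L : Logic) where
  open Logic L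

  P₊ : Set → Set
  P₊ X = Σ[ S ∈ (X → Ω) ] ⟦ ∃ₚ X S ⟧

  unitP : {X : Set} → X → P₊ X
  unitP {X} x = (λ y → Id X x y) , ∃-intro X (Id X x) x (proj₂ (Id-spec X x x) refl)

  liftP : {X Y : Set} → (X → Y) → P₊ X → P₊ Y
  liftP {X} {Y} f (S , ne) =
    (λ y → ∃ₚ X (λ z → Id Y y (f z) ∧ S z)) ,
    ∃-elim X S (∃ₚ Y (λ y → ∃ₚ X (λ z → Id Y y (f z) ∧ S z))) ne
      (λ z sz → ∃-intro Y _ (f z)
                  (∃-intro X (λ z' → Id Y (f z) (f z') ∧ S z') z
                    (proj₂ (∧-spec _ _) (proj₂ (Id-spec Y (f z) (f z)) refl , sz))))

  multP : {X : Set} → P₊ (P₊ X) → P₊ X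
  multP {X} (𝒮 , ne) =
    (λ y → ∃ₚ (P₊ X) (λ T → 𝒮 T ∧ proj₁ T y)) ,
    ∃-elim (P₊ X) 𝒮 (∃ₚ X (λ y → ∃ₚ (P₊ X) (λ T → 𝒮 T ∧ proj₁ T y))) ne
      (λ T sT → ∃-elim X (proj₁ T) (∃ₚ X (λ y → ∃ₚ (P₊ X) (λ T' → 𝒮 T' ∧ proj₁ T' y))) (proj₂ T)
        (λ y ty → ∃-intro X _ y (∃-intro (P₊ X) (λ T' → 𝒮 T' ∧ proj₁ T' y) T
                    (proj₂ (∧-spec _ _) (sT , ty)))))

record Picture (L : Logic) (Mo : Monad) : Set₁ where
  open Logic L
  open Monad Mo
  open Powerset L
  field
    picture : {X : Set} → M X → P₊ X
    picture-nat : {X Y : Set} (f : X → Y) (x : M X) → picture (lift f x) ≡ liftP f (picture x)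
    picture-inj : {X : Set} (x x' : M X) → picture x ≡ picture x' → x ≡ x'
    picture-unit : {X : Set} (x : X) → picture (unit x) ≡ unitP x
    picture-mult : {X : Set} (m : M (M X)) → picture (mult m) ≡ multP (liftP picture (picture m))
    liftP-picture-equiv : {X : Set} → IsEquiv (liftP (picture {X}))

  pic : {X : Set} → M X → X → Ω
  pic x y = proj₁ (picture x) y

  field
    select : {X : Set} (x : M X) → M (Σ[ y ∈ X ] ⟦ pic x y ⟧)
    unit-equiv : {X : Set} → IsSubsingleton X → IsEquiv (unit {X})

module MQuant (L : Logic) (Mo : Monad) where
  open Logic L
  open Monad Mo

  ∧ᴹ : M Ω → Ω
  ∧ᴹ z = Id (M Ω) z (unit True)

  ∨ᴹ : M Ω → Ω
  ∨ᴹ z = ¬ₚ (Id (M Ω) z (unit False))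

  ∀ᴹ : {X : Set} → M X → (X → Ω) → Ω
  ∀ᴹ x P = ∧ᴹ (lift P x)

  ∃ᴹ : {X : Set} → M X → (X → Ω) → Ω
  ∃ᴹ x P = ∨ᴹ (lift P x)

  _∈ᴹ_ : {X : Set} → X → M X → Ω
  _∈ᴹ_ {X} y x = ∃ᴹ x (λ z → Id X y z)

module _ (L : Logic) (Mo : Monad) (Pc : Picture L Mo) where
  open Logic L
  open Monad Mo
  open Picture Pc
  open MQuant L Mo

  QuantifierClaim : {X : Set} (P : X → Ω) (x : M X) → Set
  QuantifierClaim {X} P x =
      (∀ᴹ x P ≡ Πₚ X (λ y → pic x y ⇒ P y))
    × (∃ᴹ x P ≡ ∃ₚ X (λ y → pic x y ∧ P y))
    × ((y : X) → (y ∈ᴹ x) ≡ pic x y)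

-- The picture of lift P x is the image of P on the picture of x, and the
-- picture of unit c is {c}.  Since picture is injective and natural,
-- lift P x = unit c holds exactly when P is constantly c on the (nonempty)
-- picture of x.  Taking c = True gives ∀ᴹ; taking c = False and reasoning
-- classically gives ∃ᴹ; ∈ᴹ is ∃ᴹ with P = (y ≡_).
{-# OPTIONS --safe #-}
module Submission where

open import Defs
open import Data.Product using (_×_; _,_; proj₁; proj₂)
open import Data.Empty using (⊥; ⊥-elim)
open import Data.Unit using (tt)
open import Relation.Binary.PropositionalEquality using (_≡_; refl; sym; trans; cong; subst)

module LogicProperties (L : Logic) where
  open Logic L

  True-intro : ⟦ True ⟧
  True-intro = proj₂ True-spec tt

  False-elim : {A : Set} → ⟦ False ⟧ → A
  False-elim f = ⊥-elim (proj₁ False-spec f)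

  Id-intro : {A : Set} {a b : A} → a ≡ b → ⟦ Id A a b ⟧
  Id-intro = proj₂ (Id-spec _ _ _)

  Id-elim : {A : Set} {a b : A} → ⟦ Id A a b ⟧ → a ≡ b
  Id-elim = proj₁ (Id-spec _ _ _)

  ∧-intro : {P Q : Ω} → ⟦ P ⟧ → ⟦ Q ⟧ → ⟦ P ∧ Q ⟧
  ∧-intro p q = proj₂ (∧-spec _ _) (p , q)

  ∧-elim : {P Q : Ω} → ⟦ P ∧ Q ⟧ → ⟦ P ⟧ × ⟦ Q ⟧
  ∧-elim = proj₁ (∧-spec _ _)

  ¬ₚ-elim : {P : Ω} → ⟦ ¬ₚ P ⟧ → ⟦ P ⟧ → ⊥
  ¬ₚ-elim n p = False-elim (proj₁ (⇒-spec _ _) n p)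

  ≡True⇔ : (Q : Ω) → (Q ≡ True) ⇔ ⟦ Q ⟧
  ≡True⇔ Q = (λ { refl → True-intro }) , (λ q → propext Q True (λ _ → True-intro) (λ _ → q))

  ≡False⇔ : (Q : Ω) → (Q ≡ False) ⇔ (⟦ Q ⟧ → ⊥)
  ≡False⇔ Q = (λ { refl → False-elim }) , (λ n → propext Q False (λ q → ⊥-elim (n q)) False-elim)

  ¬¬-elim : (Q : Ω) → ((⟦ Q ⟧ → ⊥) → ⊥) → ⟦ Q ⟧
  ¬¬-elim Q nnq = ∨-elim Q (¬ₚ Q) Q (lem Q) (λ q → q) (λ nq → ⊥-elim (nnq (¬ₚ-elim nq)))

module PowersetProperties (L : Logic) (fe : FunExt) where
  open Logic L
  open LogicProperties L
  open Powerset L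

  P₊-≡ : {X : Set} {S T : P₊ X} → proj₁ S ≡ proj₁ T → S ≡ T
  P₊-≡ {S = S , p} {T = .S , q} refl = cong (S ,_) (⟦⟧-prop _ p q)

  liftP≡unitP⇒const : {X Y : Set} (f : X → Y) (S : P₊ X) (c : Y) →
    liftP f S ≡ unitP c → (x : X) → ⟦ proj₁ S x ⟧ → f x ≡ c
  liftP≡unitP⇒const {X} {Y} f S c e x sx =
    sym (Id-elim (subst (λ T → ⟦ proj₁ T (f x) ⟧) e f[S]∋fx))
    where
    f[S]∋fx : ⟦ proj₁ (liftP f S) (f x) ⟧
    f[S]∋fx = ∃-intro X _ x (∧-intro (Id-intro refl) sx)

  -- The image of S is contained in {c} by hypothesis, and contains c because S is nonempty.
  const⇒liftP≡unitP : {X Y : Set} (f : X → Y) (S : P₊ X) (c : Y) →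
    ((x : X) → ⟦ proj₁ S x ⟧ → f x ≡ c) → liftP f S ≡ unitP c
  const⇒liftP≡unitP {X} {Y} f (S , nonempty) c const =
    P₊-≡ (fe λ y → propext _ _ (image⊆singleton y) (singleton⊆image y))
    where
    image⊆singleton : (y : Y) → ⟦ ∃ₚ X (λ x → Id Y y (f x) ∧ S x) ⟧ → ⟦ Id Y c y ⟧
    image⊆singleton y h = ∃-elim X _ (Id Y c y) h λ x hx →
      let (y≡fx , sx) = ∧-elim hx in
      Id-intro (sym (trans (Id-elim y≡fx) (const x sx)))

    singleton⊆image : (y : Y) → ⟦ Id Y c y ⟧ → ⟦ ∃ₚ X (λ x → Id Y y (f x) ∧ S x) ⟧
    singleton⊆image y c≡y = ∃-elim X S _ nonempty λ x sx →
      ∃-intro X _ x (∧-intro (Id-intro (trans (sym (Id-elim c≡y)) (sym (const x sx)))) sx)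

module PictureProperties (L : Logic) (fe : FunExt) (Mo : Monad) (Pc : Picture L Mo) where
  open Logic L
  open Monad Mo
  open Picture Pc
  open Powerset L
  open PowersetProperties L fe

  lift≡unit⇔liftP≡unitP : {X Y : Set} (f : X → Y) (x : M X) (c : Y) →
    (lift f x ≡ unit c) ⇔ (liftP f (picture x) ≡ unitP c)
  lift≡unit⇔liftP≡unitP f x c =
    (λ e → trans (sym (picture-nat f x)) (trans (cong picture e) (picture-unit c))) ,
    (λ e → picture-inj _ _ (trans (picture-nat f x) (trans e (sym (picture-unit c)))))

  lift≡unit⇔const : {X Y : Set} (f : X → Y) (x : M X) (c : Y) →
    (lift f x ≡ unit c) ⇔ ((y : X) → ⟦ pic x y ⟧ → f y ≡ c)
  lift≡unit⇔const f x c =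
    (λ e → liftP≡unitP⇒const f (picture x) c (proj₁ (lift≡unit⇔liftP≡unitP f x c) e)) ,
    (λ h → proj₂ (lift≡unit⇔liftP≡unitP f x c) (const⇒liftP≡unitP f (picture x) c h))

module QuantifierProperties (L : Logic) (fe : FunExt) (Mo : Monad) (Pc : Picture L Mo) where
  open Logic L
  open Monad Mo
  open Picture Pc
  open MQuant L Mo
  open LogicProperties L
  open PictureProperties L fe Mo Pc

  ∀ᴹ-pic : {X : Set} (P : X → Ω) (x : M X) → ∀ᴹ x P ≡ Πₚ X (λ y → pic x y ⇒ P y)
  ∀ᴹ-pic {X} P x = propext _ _
    (λ h → proj₂ (Π-spec _ _) λ y → proj₂ (⇒-spec _ _) λ py →
      proj₁ (≡True⇔ (P y)) (proj₁ (lift≡unit⇔const P x True) (Id-elim h) y py))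
    (λ h → Id-intro (proj₂ (lift≡unit⇔const P x True) λ y py →
      proj₂ (≡True⇔ (P y)) (proj₁ (⇒-spec _ _) (proj₁ (Π-spec _ _) h y) py)))

  ∃ᴹ-pic : {X : Set} (P : X → Ω) (x : M X) → ∃ᴹ x P ≡ ∃ₚ X (λ y → pic x y ∧ P y)
  ∃ᴹ-pic {X} P x = propext _ _
    (λ h → ¬¬-elim E λ ¬E → ¬ₚ-elim h (Id-intro (no-witness⇒lift≡unitFalse ¬E)))
    (λ e → proj₂ (⇒-spec _ _) λ h → ⊥-elim (lift≡unitFalse⇒no-witness (Id-elim h) e))
    where
    E : Ω
    E = ∃ₚ X (λ y → pic x y ∧ P y)

    no-witness⇒lift≡unitFalse : (⟦ E ⟧ → ⊥) → lift P x ≡ unit False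
    no-witness⇒lift≡unitFalse ¬E = proj₂ (lift≡unit⇔const P x False) λ y py →
      proj₂ (≡False⇔ (P y)) λ p → ¬E (∃-intro X _ y (∧-intro py p))

    lift≡unitFalse⇒no-witness : lift P x ≡ unit False → ⟦ E ⟧ → ⊥
    lift≡unitFalse⇒no-witness e hE = False-elim (∃-elim X _ False hE λ y hy →
      let (py , p) = ∧-elim hy in
      subst ⟦_⟧ (proj₁ (lift≡unit⇔const P x False) e y py) p)

  ∈ᴹ-pic : {X : Set} (x : M X) (y : X) → (y ∈ᴹ x) ≡ pic x y
  ∈ᴹ-pic {X} x y = trans (∃ᴹ-pic (Id X y) x) (propext _ _
    (λ h → ∃-elim X _ (pic x y) h λ z hz →
      let (pz , y≡z) = ∧-elim hz in
      subst (λ w → ⟦ pic x w ⟧) (sym (Id-elim y≡z)) pz)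
    (λ py → ∃-intro X _ y (∧-intro py (Id-intro refl))))

mainTheorem3 : (L : Logic) → FunExt → (Mo : Monad) → (Pc : Picture L Mo) →
    {X : Set} (P : X → Logic.Ω L) (x : Monad.M Mo X) → QuantifierClaim L Mo Pc P x
mainTheorem3 L fe Mo Pc P x = ∀ᴹ-pic P x , ∃ᴹ-pic P x , ∈ᴹ-pic x
  where open QuantifierProperties L fe Mo Pc
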